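{- Let $s\ge 2$ be an integer and $K>0$. There is a constant $C>0$ depending only on $s$ and $K$ such that the following holds. If $N\ge1$ and $A\subseteq[N]=\{1,\dots,N\}$ satisfies $E_s(1_A,1_{ -A})\le K|A|^s$, then \[ E_2(1_A,1_{ -A})\le C|A|^{3-\frac{1}{s-1}}\qquad\text{and}\qquad E_{s-1}(1_A,1_{ -A})\le C|A|^{s-\frac{s-2}{s-1}}. \]
   Context: For finitely supported $f,g:\mathbb{Z}\to\mathbb{R}$, $(f*g)(x)=\sum_{y\in\mathbb{Z}}f(y)g(x-y)$, and for an integer $m\ge1$ the $m$-th moment energy is $E_m(f,g)=\sum_{n\in\mathbb{Z}}\big((f*g)(n)\big)^m$. Here $1_A$ is the indicator function of $A$ and $1_{ -A}$ that of $-A=\{ -a:a\in A\}$, so $(1_A*1_{ -A})(d)=\#\{(a,a')\in A^2: a-a'=d\}$.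
   Formalization: The constant K ranges over the positive rationals, and the constant C is taken in the rationals. -}

module Defs where

open import Data.Nat as ℕ using (ℕ; zero; suc)
open import Data.Integer as ℤ using (ℤ; +_; -[1+_])
open import Data.List using (List; length)
open import Data.List.Membership.DecPropositional ℕ._≟_ using (_∈?_)
open import Data.Rational as ℚ using (ℚ)
open import Relation.Nullary using (yes; no)

sumWin : ℕ → (ℤ → ℕ) → ℕ
sumWin zero    f = f (+ 0)
sumWin (suc M) f = f (+ suc M) ℕ.+ f (-[1+ M ]) ℕ.+ sumWin M f

ind : List ℕ → ℤ → ℕ
ind A (+ n)    with n ∈? A
... | yes _ = 1
... | no  _ = 0
ind A -[1+ n ] = 0

indNeg : List ℕ → ℤ → ℕ
indNeg A z = ind A (ℤ.- z)

-- Convolution (f*g)(x) = Σ_y f(y) g(x-y), with y restricted to the window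
-- [-M, M]; this is the exact convolution whenever supp f ⊆ [-M, M].
conv : ℕ → (ℤ → ℕ) → (ℤ → ℕ) → ℤ → ℕ
conv M f g x = sumWin M (λ y → f y ℕ.* g (x ℤ.- y))

-- m-th moment energy E_m(f,g) = Σ_n ((f*g)(n))^m, for f, g supported in
-- [-M, M] (so f*g is supported in [-2M, 2M]; the sums are exact).
energy : ℕ → ℕ → (ℤ → ℕ) → (ℤ → ℕ) → ℕ
energy M m f g = sumWin (2 ℕ.* M) (λ n → conv M f g n ℕ.^ m)

-- E_m(1_A, 1_{-A}) for A ⊆ [N] (both indicators supported in [-N, N]).
E : ℕ → ℕ → List ℕ → ℕ
E N m A = energy N m (ind A) (indNeg A)

_^ℚ_ : ℚ → ℕ → ℚ
q ^ℚ zero  = ℚ.1ℚ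
q ^ℚ suc n = q ℚ.* (q ^ℚ n)

toℚ : ℕ → ℚ
toℚ n = (+ n) ℚ./ 1

-- Write r = 1_A * 1_{-A} and P k = Σ_d r(d)^k, so that E_k(1_A, 1_{-A}) = P k and P 1 ≤ |A|².
-- The sequence P is log-convex, P (a + c) · P (b + c) ≤ P c · P (a + b + c): expanding both
-- products over pairs of values x, y of r and factoring out (xy)^c, this is (x^a − y^a)(x^b − y^b) ≥ 0.
-- Iterating its case a = 1 gives P 2 ^ (s−1) ≤ P 1 ^ (s−2) · P s and P (s−1) ^ (s−1) ≤ P 1 · P s ^ (s−2);
-- inserting P 1 ≤ |A|² and P s ≤ K |A|^s gives both bounds, raised to the power s − 1 to avoid
-- fractional exponents, with C = 1 + K since then C^(s−1) ≥ max(K, K^(s−2)).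
-- The bound P 1 ≤ |A|² holds for every list A.

module Submission where

open import Defs
open import Data.Nat as ℕ using (ℕ; _≤_; _∸_; _*_; _+_)
open import Data.List using (List; length)
open import Data.List.Relation.Unary.All using (All)
open import Data.List.Relation.Unary.Unique.Propositional using (Unique)
open import Data.Rational as ℚ using (ℚ; Positive)
open import Data.Product using (Σ; _×_)

open import Algebra.Bundles using (CommutativeRing)
import Algebra.Properties.CommutativeSemigroup as CommSemigroupProperties
open import Data.Empty using (⊥-elim)
open import Data.Integer as ℤ using (ℤ; -[1+_])
import Data.Integer.Properties as ℤₚ
import Data.Integer.Tactic.RingSolver as ℤ-Solver
open import Data.List using ([]; _∷_; map)
open import Data.List.Membership.DecPropositional ℕ._≟_ using (_∈?_)
open import Data.List.Membership.Propositional using (_∈_)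
open import Data.List.Relation.Unary.Any using (here; there)
open import Data.Nat using (zero; suc; _<_; _^_; z≤n; s≤s; _<?_)
import Data.Nat.Coprimality as Coprimality
open import Data.Nat.ListAction using (sum)
open import Data.Nat.Properties
open import Data.Nat.Tactic.RingSolver using (solve-∀)
open import Data.Product using (_,_)
open import Data.Rational using (NonNegative; mkℚ)
import Data.Rational.Properties as ℚₚ
open import Data.Sum using (inj₁; inj₂)
open import Function using (_∘_; id)
open import Relation.Binary.PropositionalEquality
open import Relation.Nullary using (yes; no)

open CommSemigroupProperties *-commutativeSemigroup using (x∙yz≈y∙xz)
module ℚ-* = CommSemigroupProperties (CommutativeRing.*-commutativeSemigroup ℚₚ.+-*-commutativeRing)

sumWin-cong : ∀ M {f g : ℤ → ℕ} → (∀ x → f x ≡ g x) → sumWin M f ≡ sumWin M g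
sumWin-cong zero    f≗g = f≗g (ℤ.+ 0)
sumWin-cong (suc M) f≗g = cong₂ _+_ (cong₂ _+_ (f≗g _) (f≗g _)) (sumWin-cong M f≗g)

sumWin-mono-≤ : ∀ M {f g : ℤ → ℕ} → (∀ x → f x ≤ g x) → sumWin M f ≤ sumWin M g
sumWin-mono-≤ zero    f≤g = f≤g (ℤ.+ 0)
sumWin-mono-≤ (suc M) f≤g = +-mono-≤ (+-mono-≤ (f≤g _) (f≤g _)) (sumWin-mono-≤ M f≤g)

sumWin-zero : ∀ M → sumWin M (λ _ → 0) ≡ 0
sumWin-zero zero    = refl
sumWin-zero (suc M) = sumWin-zero M

sumWin-distrib-+ : ∀ M (f g : ℤ → ℕ) → sumWin M (λ x → f x + g x) ≡ sumWin M f + sumWin M g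
sumWin-distrib-+ zero    f g = refl
sumWin-distrib-+ (suc M) f g = begin
  f p + g p + (f n + g n) + sumWin M (λ x → f x + g x)
    ≡⟨ cong ((f p + g p + (f n + g n)) +_) (sumWin-distrib-+ M f g) ⟩
  f p + g p + (f n + g n) + (sumWin M f + sumWin M g)
    ≡⟨ interchange (f p) (g p) (f n) (g n) (sumWin M f) (sumWin M g) ⟩
  f p + f n + sumWin M f + (g p + g n + sumWin M g) ∎
  where
  open ≡-Reasoning
  p n : ℤ
  p = ℤ.+ suc M
  n = -[1+ M ]
  interchange : ∀ a b c d e f → a + b + (c + d) + (e + f) ≡ a + c + e + (b + d + f)
  interchange = solve-∀

sumWin-*ˡ : ∀ M c (f : ℤ → ℕ) → sumWin M (λ x → c * f x) ≡ c * sumWin M f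
sumWin-*ˡ zero    c f = refl
sumWin-*ˡ (suc M) c f = begin
  c * f p + c * f n + sumWin M (λ x → c * f x)  ≡⟨ cong ((c * f p + c * f n) +_) (sumWin-*ˡ M c f) ⟩
  c * f p + c * f n + c * sumWin M f            ≡⟨ factor c (f p) (f n) (sumWin M f) ⟩
  c * (f p + f n + sumWin M f)                  ∎
  where
  open ≡-Reasoning
  p n : ℤ
  p = ℤ.+ suc M
  n = -[1+ M ]
  factor : ∀ c a b d → c * a + c * b + c * d ≡ c * (a + b + d)
  factor = solve-∀

sumWin-*ʳ : ∀ M c (f : ℤ → ℕ) → sumWin M (λ x → f x * c) ≡ sumWin M f * c
sumWin-*ʳ M c f = begin
  sumWin M (λ x → f x * c)  ≡⟨ sumWin-cong M (λ x → *-comm (f x) c) ⟩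
  sumWin M (λ x → c * f x)  ≡⟨ sumWin-*ˡ M c f ⟩
  c * sumWin M f            ≡⟨ *-comm c _ ⟩
  sumWin M f * c            ∎
  where open ≡-Reasoning

sumWin-comm : ∀ M M′ (F : ℤ → ℤ → ℕ) →
  sumWin M (λ x → sumWin M′ (F x)) ≡ sumWin M′ (λ y → sumWin M (λ x → F x y))
sumWin-comm zero    M′ F = refl
sumWin-comm (suc M) M′ F = begin
  sumWin M′ (F p) + sumWin M′ (F n) + sumWin M (λ x → sumWin M′ (F x))
    ≡⟨ cong ((sumWin M′ (F p) + sumWin M′ (F n)) +_) (sumWin-comm M M′ F) ⟩
  sumWin M′ (F p) + sumWin M′ (F n) + sumWin M′ (λ y → sumWin M (λ x → F x y))
    ≡⟨ cong (_+ sumWin M′ (λ y → sumWin M (λ x → F x y))) (sumWin-distrib-+ M′ (F p) (F n)) ⟨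
  sumWin M′ (λ y → F p y + F n y) + sumWin M′ (λ y → sumWin M (λ x → F x y))
    ≡⟨ sumWin-distrib-+ M′ _ _ ⟨
  sumWin M′ (λ y → F p y + F n y + sumWin M (λ x → F x y)) ∎
  where
  open ≡-Reasoning
  p n : ℤ
  p = ℤ.+ suc M
  n = -[1+ M ]

δ : ℤ → ℤ → ℕ
δ z w with z ℤ.≟ w
... | yes _ = 1
... | no  _ = 0

δ-≡ : ∀ {z w} → z ≡ w → δ z w ≡ 1
δ-≡ {z} {w} z≡w with z ℤ.≟ w
... | yes _   = refl
... | no  z≢w = ⊥-elim (z≢w z≡w)

δ-≢ : ∀ {z w} → z ≢ w → δ z w ≡ 0
δ-≢ {z} {w} z≢w with z ℤ.≟ w
... | yes z≡w = ⊥-elim (z≢w z≡w)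
... | no  _   = refl

δ≤1 : ∀ z w → δ z w ≤ 1
δ≤1 z w with z ℤ.≟ w
... | yes _ = ≤-refl
... | no  _ = z≤n

δ-mono : ∀ {z w z′ w′} → (z ≡ w → z′ ≡ w′) → δ z w ≤ δ z′ w′
δ-mono {z} {w} imp with z ℤ.≟ w
... | yes z≡w = ≤-reflexive (sym (δ-≡ (imp z≡w)))
... | no  _   = z≤n

δ+δ≤1 : ∀ x y p → x ≢ y → δ x p + δ y p ≤ 1
δ+δ≤1 x y p x≢y with x ℤ.≟ p
... | yes refl = ≤-reflexive (cong suc (δ-≢ (x≢y ∘ sym)))
... | no  _    = δ≤1 y p

∣∣<∣∣⇒≢ : ∀ x y → ℤ.∣ x ∣ < ℤ.∣ y ∣ → x ≢ y
∣∣<∣∣⇒≢ x y ∣x∣<∣y∣ x≡y = <⇒≢ ∣x∣<∣y∣ (cong ℤ.∣_∣ x≡y)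

sumWin-δ-outside : ∀ M p → M < ℤ.∣ p ∣ → sumWin M (λ x → δ x p) ≡ 0
sumWin-δ-outside zero    p 0<∣p∣ = δ-≢ (∣∣<∣∣⇒≢ (ℤ.+ 0) p 0<∣p∣)
sumWin-δ-outside (suc M) p M<∣p∣ = begin
  δ (ℤ.+ suc M) p + δ -[1+ M ] p + sumWin M (λ x → δ x p)
    ≡⟨ cong₂ _+_ (cong₂ _+_ (δ-≢ (∣∣<∣∣⇒≢ (ℤ.+ suc M) p M<∣p∣))
                            (δ-≢ (∣∣<∣∣⇒≢ -[1+ M ] p M<∣p∣)))
                 (sumWin-δ-outside M p (<-trans (n<1+n M) M<∣p∣)) ⟩
  0 ∎
  where open ≡-Reasoning

sumWin-δ≤1 : ∀ M p → sumWin M (λ x → δ x p) ≤ 1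
sumWin-δ≤1 zero    p = δ≤1 (ℤ.+ 0) p
sumWin-δ≤1 (suc M) p with M <? ℤ.∣ p ∣
... | yes M<∣p∣ = begin
  δ (ℤ.+ suc M) p + δ -[1+ M ] p + sumWin M (λ x → δ x p)
    ≡⟨ cong ((δ (ℤ.+ suc M) p + δ -[1+ M ] p) +_) (sumWin-δ-outside M p M<∣p∣) ⟩
  δ (ℤ.+ suc M) p + δ -[1+ M ] p + 0
    ≡⟨ +-identityʳ _ ⟩
  δ (ℤ.+ suc M) p + δ -[1+ M ] p
    ≤⟨ δ+δ≤1 (ℤ.+ suc M) -[1+ M ] p (λ ()) ⟩
  1 ∎
  where open ≤-Reasoning
... | no M≮∣p∣ = begin
  δ (ℤ.+ suc M) p + δ -[1+ M ] p + sumWin M (λ x → δ x p)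
    ≡⟨ cong (_+ sumWin M (λ x → δ x p)) (cong₂ _+_ (δ-≢ (∣∣<∣∣⇒≢ p (ℤ.+ suc M) ∣p∣<1+M ∘ sym))
                                                  (δ-≢ (∣∣<∣∣⇒≢ p -[1+ M ] ∣p∣<1+M ∘ sym))) ⟩
  sumWin M (λ x → δ x p)
    ≤⟨ sumWin-δ≤1 M p ⟩
  1 ∎
  where
  open ≤-Reasoning
  ∣p∣<1+M : ℤ.∣ p ∣ < suc M
  ∣p∣<1+M = s≤s (≮⇒≥ M≮∣p∣)

∈⇒1≤δ-sum : ∀ {n A} → n ∈ A → 1 ≤ sum (map (δ (ℤ.+ n) ∘ ℤ.+_) A)
∈⇒1≤δ-sum {n} (here refl) = ≤-trans (≤-reflexive (sym (δ-≡ {ℤ.+ n} refl))) (m≤m+n _ _)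
∈⇒1≤δ-sum     (there n∈A) = ≤-trans (∈⇒1≤δ-sum n∈A) (m≤n+m _ _)

ind≤δ-sum : ∀ A z → ind A z ≤ sum (map (δ z ∘ ℤ.+_) A)
ind≤δ-sum A (ℤ.+ n) with n ∈? A
... | yes n∈A = ∈⇒1≤δ-sum n∈A
... | no  _   = z≤n
ind≤δ-sum A -[1+ n ] = z≤n

sumWin-ind∘≤length : ∀ M A (h g : ℤ → ℤ) → (∀ x → g (h x) ≡ x) →
  sumWin M (λ x → ind A (h x)) ≤ length A
sumWin-ind∘≤length M A h g g∘h≗id = ≤-trans (sumWin-mono-≤ M (ind≤δ-sum A ∘ h)) (bound A)
  where
  open ≤-Reasoning
  atMostOnce : ∀ p → sumWin M (λ x → δ (h x) p) ≤ 1
  atMostOnce p = begin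
    sumWin M (λ x → δ (h x) p)  ≤⟨ sumWin-mono-≤ M (λ x → δ-mono (trans (sym (g∘h≗id x)) ∘ cong g)) ⟩
    sumWin M (λ x → δ x (g p))  ≤⟨ sumWin-δ≤1 M (g p) ⟩
    1                           ∎
  bound : ∀ A → sumWin M (λ x → sum (map (δ (h x) ∘ ℤ.+_) A)) ≤ length A
  bound []      = ≤-reflexive (sumWin-zero M)
  bound (a ∷ A) = begin
    sumWin M (λ x → δ (h x) (ℤ.+ a) + sum (map (δ (h x) ∘ ℤ.+_) A))
      ≡⟨ sumWin-distrib-+ M _ _ ⟩
    sumWin M (λ x → δ (h x) (ℤ.+ a)) + sumWin M (λ x → sum (map (δ (h x) ∘ ℤ.+_) A))
      ≤⟨ +-mono-≤ (atMostOnce (ℤ.+ a)) (bound A) ⟩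
    suc (length A) ∎

energy₁≤ : ∀ M (f g : ℤ → ℕ) G → (∀ y → sumWin (2 * M) (λ x → g (x ℤ.- y)) ≤ G) →
  energy M 1 f g ≤ sumWin M f * G
energy₁≤ M f g G translates≤G = begin
  sumWin (2 * M) (λ x → sumWin M (λ y → f y * g (x ℤ.- y)) ^ 1)
    ≡⟨ sumWin-cong (2 * M) (λ x → *-identityʳ _) ⟩
  sumWin (2 * M) (λ x → sumWin M (λ y → f y * g (x ℤ.- y)))
    ≡⟨ sumWin-comm (2 * M) M _ ⟩
  sumWin M (λ y → sumWin (2 * M) (λ x → f y * g (x ℤ.- y)))
    ≡⟨ sumWin-cong M (λ y → sumWin-*ˡ (2 * M) (f y) _) ⟩
  sumWin M (λ y → f y * sumWin (2 * M) (λ x → g (x ℤ.- y)))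
    ≤⟨ sumWin-mono-≤ M (λ y → *-monoʳ-≤ (f y) (translates≤G y)) ⟩
  sumWin M (λ y → f y * G)
    ≡⟨ sumWin-*ʳ M G f ⟩
  sumWin M f * G ∎
  where open ≤-Reasoning

E₁≤∣A∣² : ∀ N A → E N 1 A ≤ length A ^ 2
E₁≤∣A∣² N A = begin
  E N 1 A               ≤⟨ energy₁≤ N (ind A) (indNeg A) n reflected≤n ⟩
  sumWin N (ind A) * n  ≤⟨ *-monoˡ-≤ n (sumWin-ind∘≤length N A id id (λ _ → refl)) ⟩
  n * n                 ≡⟨ cong (n *_) (*-identityʳ n) ⟨
  n ^ 2                 ∎
  where
  open ≤-Reasoning
  n : ℕ
  n = length A
  reflect-inverse : ∀ y x → y ℤ.- ℤ.- (x ℤ.- y) ≡ x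
  reflect-inverse = ℤ-Solver.solve-∀
  reflected≤n : ∀ y → sumWin (2 * N) (λ x → indNeg A (x ℤ.- y)) ≤ n
  reflected≤n y =
    sumWin-ind∘≤length (2 * N) A (λ x → ℤ.- (x ℤ.- y)) (λ p → y ℤ.- p) (reflect-inverse y)

powerSum : ℕ → List ℕ → ℕ
powerSum k xs = sum (map (_^ k) xs)

*-+-rearrangement : ∀ {u U v V} → u ≤ U → v ≤ V → u * V + U * v ≤ u * v + U * V
*-+-rearrangement {u} {v = v} u≤U v≤V with m≤n⇒∃[o]m+o≡n u≤U | m≤n⇒∃[o]m+o≡n v≤V
... | p , refl | q , refl = ≤-trans (m≤m+n _ (p * q)) (≤-reflexive (expand u v p q))
  where
  expand : ∀ u v p q → u * (v + q) + (u + p) * v + p * q ≡ u * v + (u + p) * (v + q)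
  expand = solve-∀

^-rearrangement : ∀ x y a b → y ^ a * x ^ b + x ^ a * y ^ b ≤ x ^ a * x ^ b + y ^ a * y ^ b
^-rearrangement x y a b with ≤-total x y
... | inj₁ x≤y = subst (_≤ x ^ a * x ^ b + y ^ a * y ^ b) (+-comm (x ^ a * y ^ b) _)
                   (*-+-rearrangement (^-monoˡ-≤ a x≤y) (^-monoˡ-≤ b x≤y))
... | inj₂ y≤x = subst (y ^ a * x ^ b + x ^ a * y ^ b ≤_) (+-comm (y ^ a * y ^ b) _)
                   (*-+-rearrangement (^-monoˡ-≤ a y≤x) (^-monoˡ-≤ b y≤x))

^-pair-logConvex : ∀ a b c x y →
  y ^ (a + c) * x ^ (b + c) + x ^ (a + c) * y ^ (b + c) ≤ y ^ c * x ^ (a + b + c) + x ^ c * y ^ (a + b + c)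
^-pair-logConvex a b c x y = begin
  y ^ (a + c) * x ^ (b + c) + x ^ (a + c) * y ^ (b + c)
    ≡⟨ cong₂ _+_ (cong₂ _*_ (^-distribˡ-+-* y a c) (^-distribˡ-+-* x b c))
                 (cong₂ _*_ (^-distribˡ-+-* x a c) (^-distribˡ-+-* y b c)) ⟩
  y ^ a * Y * (x ^ b * X) + x ^ a * X * (y ^ b * Y)
    ≡⟨ factorˡ (y ^ a) (y ^ b) (x ^ a) (x ^ b) X Y ⟩
  Y * X * (y ^ a * x ^ b + x ^ a * y ^ b)
    ≤⟨ *-monoʳ-≤ (Y * X) (^-rearrangement x y a b) ⟩
  Y * X * (x ^ a * x ^ b + y ^ a * y ^ b)
    ≡⟨ factorʳ (y ^ a) (y ^ b) (x ^ a) (x ^ b) X Y ⟩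
  Y * (x ^ a * x ^ b * X) + X * (y ^ a * y ^ b * Y)
    ≡⟨ cong₂ _+_ (cong (Y *_) (split x)) (cong (X *_) (split y)) ⟨
  Y * x ^ (a + b + c) + X * y ^ (a + b + c) ∎
  where
  open ≤-Reasoning
  X Y : ℕ
  X = x ^ c
  Y = y ^ c
  split : ∀ z → z ^ (a + b + c) ≡ z ^ a * z ^ b * z ^ c
  split z = trans (^-distribˡ-+-* z (a + b) c) (cong (_* z ^ c) (^-distribˡ-+-* z a b))
  factorˡ : ∀ ya yb xa xb X Y → ya * Y * (xb * X) + xa * X * (yb * Y) ≡ Y * X * (ya * xb + xa * yb)
  factorˡ = solve-∀
  factorʳ : ∀ ya yb xa xb X Y → Y * X * (xa * xb + ya * yb) ≡ Y * (xa * xb * X) + X * (ya * yb * Y)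
  factorʳ = solve-∀

powerSum-cross-logConvex : ∀ a b c y xs →
  y ^ (a + c) * powerSum (b + c) xs + powerSum (a + c) xs * y ^ (b + c)
    ≤ y ^ c * powerSum (a + b + c) xs + powerSum c xs * y ^ (a + b + c)
powerSum-cross-logConvex a b c y [] =
  ≤-trans (≤-reflexive (trans (+-identityʳ _) (*-zeroʳ (y ^ (a + c))))) z≤n
powerSum-cross-logConvex a b c y (x ∷ xs) = begin
  y ^ (a + c) * (x ^ (b + c) + P (b + c)) + (x ^ (a + c) + P (a + c)) * y ^ (b + c)
    ≡⟨ regroup (y ^ (a + c)) (y ^ (b + c)) (x ^ (a + c)) (x ^ (b + c)) (P (a + c)) (P (b + c)) ⟩
  (y ^ (a + c) * x ^ (b + c) + x ^ (a + c) * y ^ (b + c)) + (y ^ (a + c) * P (b + c) + P (a + c) * y ^ (b + c))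
    ≤⟨ +-mono-≤ (^-pair-logConvex a b c x y) (powerSum-cross-logConvex a b c y xs) ⟩
  (y ^ c * x ^ (a + b + c) + x ^ c * y ^ (a + b + c)) + (y ^ c * P (a + b + c) + P c * y ^ (a + b + c))
    ≡⟨ regroup (y ^ c) (y ^ (a + b + c)) (x ^ c) (x ^ (a + b + c)) (P c) (P (a + b + c)) ⟨
  y ^ c * (x ^ (a + b + c) + P (a + b + c)) + (x ^ c + P c) * y ^ (a + b + c) ∎
  where
  open ≤-Reasoning
  P : ℕ → ℕ
  P k = powerSum k xs
  regroup : ∀ ya yb xa xb A B → ya * (xb + B) + (xa + A) * yb ≡ (ya * xb + xa * yb) + (ya * B + A * yb)
  regroup = solve-∀

powerSum-logConvex : ∀ a b c xs →
  powerSum (a + c) xs * powerSum (b + c) xs ≤ powerSum c xs * powerSum (a + b + c) xs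
powerSum-logConvex a b c []       = z≤n
powerSum-logConvex a b c (y ∷ xs) = begin
  (y ^ (a + c) + P (a + c)) * (y ^ (b + c) + P (b + c))
    ≡⟨ expand (y ^ (a + c)) (y ^ (b + c)) (P (a + c)) (P (b + c)) ⟩
  y ^ (a + c) * y ^ (b + c) + (y ^ (a + c) * P (b + c) + P (a + c) * y ^ (b + c)) + P (a + c) * P (b + c)
    ≤⟨ +-mono-≤ (+-mono-≤ (≤-reflexive diagonal) (powerSum-cross-logConvex a b c y xs))
                (powerSum-logConvex a b c xs) ⟩
  y ^ c * y ^ (a + b + c) + (y ^ c * P (a + b + c) + P c * y ^ (a + b + c)) + P c * P (a + b + c)
    ≡⟨ expand (y ^ c) (y ^ (a + b + c)) (P c) (P (a + b + c)) ⟨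
  (y ^ c + P c) * (y ^ (a + b + c) + P (a + b + c)) ∎
  where
  open ≤-Reasoning
  P : ℕ → ℕ
  P k = powerSum k xs
  expand : ∀ ya yb A B → (ya + A) * (yb + B) ≡ ya * yb + (ya * B + A * yb) + A * B
  expand = solve-∀
  exponents : ∀ a b c → a + c + (b + c) ≡ c + (a + b + c)
  exponents = solve-∀
  diagonal : y ^ (a + c) * y ^ (b + c) ≡ y ^ c * y ^ (a + b + c)
  diagonal = begin-equality
    y ^ (a + c) * y ^ (b + c)  ≡⟨ ^-distribˡ-+-* y (a + c) (b + c) ⟨
    y ^ (a + c + (b + c))      ≡⟨ cong (y ^_) (exponents a b c) ⟩
    y ^ (c + (a + b + c))      ≡⟨ ^-distribˡ-+-* y c (a + b + c) ⟩
    y ^ c * y ^ (a + b + c)    ∎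

powerSum-ratio-mono : ∀ k m → k ≤ m → ∀ xs →
  powerSum (suc k) xs * powerSum m xs ≤ powerSum k xs * powerSum (suc m) xs
powerSum-ratio-mono k m k≤m xs =
  subst (λ m → powerSum (suc k) xs * powerSum m xs ≤ powerSum k xs * powerSum (suc m) xs)
        (m∸n+n≡m k≤m) (powerSum-logConvex 1 (m ∸ k) k xs)

powerSum-interpolate-second : ∀ u xs → powerSum 2 xs ^ suc u ≤ powerSum 1 xs ^ u * powerSum (2 + u) xs
powerSum-interpolate-second zero    xs = ≤-reflexive (trans (*-identityʳ _) (sym (*-identityˡ _)))
powerSum-interpolate-second (suc u) xs = begin
  P 2 * P 2 ^ suc u            ≤⟨ *-monoʳ-≤ (P 2) (powerSum-interpolate-second u xs) ⟩
  P 2 * (P 1 ^ u * P (2 + u))  ≡⟨ x∙yz≈y∙xz (P 2) (P 1 ^ u) (P (2 + u)) ⟩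
  P 1 ^ u * (P 2 * P (2 + u))  ≤⟨ *-monoʳ-≤ (P 1 ^ u) (powerSum-ratio-mono 1 (2 + u) (s≤s z≤n) xs) ⟩
  P 1 ^ u * (P 1 * P (3 + u))  ≡⟨ x∙yz≈y∙xz (P 1 ^ u) (P 1) (P (3 + u)) ⟩
  P 1 * (P 1 ^ u * P (3 + u))  ≡⟨ *-assoc (P 1) (P 1 ^ u) (P (3 + u)) ⟨
  P 1 * P 1 ^ u * P (3 + u)    ∎
  where
  open ≤-Reasoning
  P : ℕ → ℕ
  P k = powerSum k xs

powerSum-interpolate-penultimate : ∀ i c xs →
  powerSum (suc (c + i)) xs ^ suc i ≤ powerSum (suc c) xs * powerSum (2 + (c + i)) xs ^ i
powerSum-interpolate-penultimate zero    c xs =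
  ≤-reflexive (cong (λ k → powerSum (suc k) xs * 1) (+-identityʳ c))
powerSum-interpolate-penultimate (suc i) c xs rewrite +-suc c i = begin
  P t * P t ^ suc i
    ≤⟨ *-monoʳ-≤ (P t) (powerSum-interpolate-penultimate i (suc c) xs) ⟩
  P t * (P (2 + c) * P (suc t) ^ i)
    ≡⟨ *-assoc (P t) (P (2 + c)) _ ⟨
  P t * P (2 + c) * P (suc t) ^ i
    ≡⟨ cong (_* P (suc t) ^ i) (*-comm (P t) (P (2 + c))) ⟩
  P (2 + c) * P t * P (suc t) ^ i
    ≤⟨ *-monoˡ-≤ (P (suc t) ^ i) (powerSum-ratio-mono (suc c) t (m≤n⇒m≤1+n (s≤s (m≤m+n c i))) xs) ⟩
  P (suc c) * P (suc t) * P (suc t) ^ i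
    ≡⟨ *-assoc (P (suc c)) (P (suc t)) _ ⟩
  P (suc c) * (P (suc t) * P (suc t) ^ i) ∎
  where
  open ≤-Reasoning
  P : ℕ → ℕ
  P k = powerSum k xs
  t : ℕ
  t = 2 + (c + i)

windowValues : ℕ → (ℤ → ℕ) → List ℕ
windowValues zero    f = f (ℤ.+ 0) ∷ []
windowValues (suc M) f = f (ℤ.+ suc M) ∷ f -[1+ M ] ∷ windowValues M f

sumWin-∘ : ∀ M (f : ℤ → ℕ) (h : ℕ → ℕ) → sumWin M (h ∘ f) ≡ sum (map h (windowValues M f))
sumWin-∘ zero    f h = sym (+-identityʳ _)
sumWin-∘ (suc M) f h = trans (cong ((h (f (ℤ.+ suc M)) + h (f -[1+ M ])) +_) (sumWin-∘ M f h))
                             (+-assoc (h (f (ℤ.+ suc M))) _ _)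

energy≡powerSum : ∀ M k (f g : ℤ → ℕ) → energy M k f g ≡ powerSum k (windowValues (2 * M) (conv M f g))
energy≡powerSum M k f g = sumWin-∘ (2 * M) (conv M f g) (_^ k)

energy-interpolate-second : ∀ M u (f g : ℤ → ℕ) →
  energy M 2 f g ^ suc u ≤ energy M 1 f g ^ u * energy M (2 + u) f g
energy-interpolate-second M u f g
  rewrite energy≡powerSum M 2 f g | energy≡powerSum M 1 f g | energy≡powerSum M (2 + u) f g
  = powerSum-interpolate-second u (windowValues (2 * M) (conv M f g))

energy-interpolate-penultimate : ∀ M u (f g : ℤ → ℕ) →
  energy M (suc u) f g ^ suc u ≤ energy M 1 f g * energy M (2 + u) f g ^ u
energy-interpolate-penultimate M u f g
  rewrite energy≡powerSum M (suc u) f g | energy≡powerSum M 1 f g | energy≡powerSum M (2 + u) f g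
  = powerSum-interpolate-penultimate u 0 (windowValues (2 * M) (conv M f g))

toℚ≡mkℚ : ∀ n → toℚ n ≡ mkℚ (ℤ.+ n) 0 (Coprimality.sym (Coprimality.1-coprimeTo n))
toℚ≡mkℚ n = ℚₚ.normalize-coprime (Coprimality.sym (Coprimality.1-coprimeTo n))

toℚ-* : ∀ a b → toℚ (a * b) ≡ toℚ a ℚ.* toℚ b
toℚ-* a b rewrite toℚ≡mkℚ a | toℚ≡mkℚ b = cong (ℚ._/ 1) (ℤₚ.pos-* a b)

toℚ-^ : ∀ a k → toℚ (a ^ k) ≡ toℚ a ^ℚ k
toℚ-^ a zero    = refl
toℚ-^ a (suc k) = trans (toℚ-* a (a ^ k)) (cong (toℚ a ℚ.*_) (toℚ-^ a k))

toℚ-mono-≤ : ∀ {a b} → a ≤ b → toℚ a ℚ.≤ toℚ b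
toℚ-mono-≤ {a} {b} a≤b rewrite toℚ≡mkℚ a | toℚ≡mkℚ b =
  ℚ.*≤* (subst₂ ℤ._≤_ (sym (ℤₚ.*-identityʳ (ℤ.+ a))) (sym (ℤₚ.*-identityʳ (ℤ.+ b))) (ℤ.+≤+ a≤b))

toℚ-nonNeg : ∀ n → NonNegative (toℚ n)
toℚ-nonNeg n rewrite toℚ≡mkℚ n = _

≤-nonNeg : ∀ {p q} → .{{NonNegative p}} → p ℚ.≤ q → NonNegative q
≤-nonNeg {p} p≤q = ℚ.nonNegative (ℚₚ.≤-trans (ℚₚ.nonNegative⁻¹ p) p≤q)

^ℚ-nonNeg : ∀ p → .{{NonNegative p}} → ∀ k → NonNegative (p ^ℚ k)
^ℚ-nonNeg p zero    = _
^ℚ-nonNeg p (suc k) = ℚₚ.nonNeg*nonNeg⇒nonNeg p (p ^ℚ k) {{^ℚ-nonNeg p k}}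

^ℚ-distribʳ-* : ∀ p q k → (p ℚ.* q) ^ℚ k ≡ p ^ℚ k ℚ.* q ^ℚ k
^ℚ-distribʳ-* p q zero    = refl
^ℚ-distribʳ-* p q (suc k) = trans (cong (p ℚ.* q ℚ.*_) (^ℚ-distribʳ-* p q k))
                                  (ℚ-*.interchange p q (p ^ℚ k) (q ^ℚ k))

^ℚ-monoˡ-≤ : ∀ {p q} → .{{NonNegative p}} → p ℚ.≤ q → ∀ k → p ^ℚ k ℚ.≤ q ^ℚ k
^ℚ-monoˡ-≤ p≤q zero    = ℚₚ.≤-refl
^ℚ-monoˡ-≤ {p} {q} p≤q (suc k) =
  ℚₚ.≤-trans (ℚₚ.*-monoʳ-≤-nonNeg (p ^ℚ k) {{^ℚ-nonNeg p k}} p≤q)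
             (ℚₚ.*-monoˡ-≤-nonNeg q {{≤-nonNeg p≤q}} (^ℚ-monoˡ-≤ p≤q k))

1≤^ℚ : ∀ {c} → ℚ.1ℚ ℚ.≤ c → ∀ k → ℚ.1ℚ ℚ.≤ c ^ℚ k
1≤^ℚ 1≤c k = ℚₚ.≤-trans (ℚₚ.≤-reflexive (sym (1^ℚ k))) (^ℚ-monoˡ-≤ 1≤c k)
  where
  1^ℚ : ∀ k → ℚ.1ℚ ^ℚ k ≡ ℚ.1ℚ
  1^ℚ zero    = refl
  1^ℚ (suc k) = trans (ℚₚ.*-identityˡ _) (1^ℚ k)

^ℚ-monoʳ-≤ : ∀ {c} → ℚ.1ℚ ℚ.≤ c → ∀ {j k} → j ≤ k → c ^ℚ j ℚ.≤ c ^ℚ k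
^ℚ-monoʳ-≤ 1≤c {k = k} z≤n = 1≤^ℚ 1≤c k
^ℚ-monoʳ-≤ {c} 1≤c (s≤s j≤k) = ℚₚ.*-monoˡ-≤-nonNeg c {{≤-nonNeg 1≤c}} (^ℚ-monoʳ-≤ 1≤c j≤k)

p≤q+p : ∀ p q → .{{NonNegative q}} → p ℚ.≤ q ℚ.+ p
p≤q+p p q = subst (ℚ._≤ q ℚ.+ p) (ℚₚ.+-identityˡ p) (ℚₚ.+-monoˡ-≤ p (ℚₚ.nonNegative⁻¹ q))

infix 4 _≤[_]_
record _≤[_]_ (a : ℕ) (K : ℚ) (b : ℕ) : Set where
  constructor scaled
  field toℚ-≤ : toℚ a ℚ.≤ K ℚ.* toℚ b

open _≤[_]_

≤-≤[]-trans : ∀ {a a′ b K} → a ≤ a′ → a′ ≤[ K ] b → a ≤[ K ] b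
≤-≤[]-trans a≤a′ (scaled a′≤Kb) = scaled (ℚₚ.≤-trans (toℚ-mono-≤ a≤a′) a′≤Kb)

≤[]-weaken : ∀ {a b K K′} → K ℚ.≤ K′ → a ≤[ K ] b → a ≤[ K′ ] b
≤[]-weaken {b = b} K≤K′ (scaled a≤Kb) =
  scaled (ℚₚ.≤-trans a≤Kb (ℚₚ.*-monoʳ-≤-nonNeg (toℚ b) {{toℚ-nonNeg b}} K≤K′))

≤[]-*ˡ : ∀ c {a b K} → a ≤[ K ] b → c * a ≤[ K ] c * b
≤[]-*ˡ c {a} {b} {K} (scaled a≤Kb) = scaled (begin
  toℚ (c * a)                  ≡⟨ toℚ-* c a ⟩
  toℚ c ℚ.* toℚ a              ≤⟨ ℚₚ.*-monoˡ-≤-nonNeg (toℚ c) {{toℚ-nonNeg c}} a≤Kb ⟩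
  toℚ c ℚ.* (K ℚ.* toℚ b)      ≡⟨ ℚ-*.x∙yz≈y∙xz (toℚ c) K (toℚ b) ⟩
  K ℚ.* (toℚ c ℚ.* toℚ b)      ≡⟨ cong (K ℚ.*_) (toℚ-* c b) ⟨
  K ℚ.* toℚ (c * b)            ∎)
  where open ℚₚ.≤-Reasoning

≤[]-^ : ∀ {a b K} → a ≤[ K ] b → ∀ k → a ^ k ≤[ K ^ℚ k ] b ^ k
≤[]-^ {a} {b} {K} (scaled a≤Kb) k = scaled (begin
  toℚ (a ^ k)                  ≡⟨ toℚ-^ a k ⟩
  toℚ a ^ℚ k                   ≤⟨ ^ℚ-monoˡ-≤ {{toℚ-nonNeg a}} a≤Kb k ⟩
  (K ℚ.* toℚ b) ^ℚ k           ≡⟨ ^ℚ-distribʳ-* K (toℚ b) k ⟩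
  K ^ℚ k ℚ.* toℚ b ^ℚ k        ≡⟨ cong (K ^ℚ k ℚ.*_) (toℚ-^ b k) ⟨
  K ^ℚ k ℚ.* toℚ (b ^ k)       ∎)
  where open ℚₚ.≤-Reasoning

E₂-bound : ∀ N A u {K} → E N (2 + u) A ≤[ K ] length A ^ (2 + u) →
  E N 2 A ^ suc u ≤[ K ] length A ^ (3 * (2 + u) ∸ 4)
E₂-bound N A u {K} Eₛ≤Knˢ =
  subst (E N 2 A ^ suc u ≤[ K ]_) exponents (≤-≤[]-trans interpolation (≤[]-*ˡ ((n ^ 2) ^ u) Eₛ≤Knˢ))
  where
  open ≡-Reasoning
  n : ℕ
  n = length A
  interpolation : E N 2 A ^ suc u ≤ (n ^ 2) ^ u * E N (2 + u) A
  interpolation = ≤-trans (energy-interpolate-second N u (ind A) (indNeg A))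
                          (*-monoˡ-≤ (E N (2 + u) A) (^-monoˡ-≤ u (E₁≤∣A∣² N A)))
  arithmetic : ∀ u → 3 * (2 + u) ≡ 4 + (2 * u + (2 + u))
  arithmetic = solve-∀
  exponents : (n ^ 2) ^ u * n ^ (2 + u) ≡ n ^ (3 * (2 + u) ∸ 4)
  exponents = begin
    (n ^ 2) ^ u * n ^ (2 + u)  ≡⟨ cong (_* n ^ (2 + u)) (^-*-assoc n 2 u) ⟩
    n ^ (2 * u) * n ^ (2 + u)  ≡⟨ ^-distribˡ-+-* n (2 * u) (2 + u) ⟨
    n ^ (2 * u + (2 + u))      ≡⟨ cong (n ^_) (m+n∸m≡n 4 (2 * u + (2 + u))) ⟨
    n ^ (4 + (2 * u + (2 + u)) ∸ 4)  ≡⟨ cong (λ e → n ^ (e ∸ 4)) (arithmetic u) ⟨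
    n ^ (3 * (2 + u) ∸ 4)      ∎

E-penultimate-bound : ∀ N A u {K} → E N (2 + u) A ≤[ K ] length A ^ (2 + u) →
  E N (suc u) A ^ suc u ≤[ K ^ℚ u ] length A ^ ((2 + u) * (2 + u) + 2 ∸ 2 * (2 + u))
E-penultimate-bound N A u {K} Eₛ≤Knˢ =
  subst (E N (suc u) A ^ suc u ≤[ K ^ℚ u ]_) exponents
        (≤-≤[]-trans interpolation (≤[]-*ˡ (n ^ 2) (≤[]-^ Eₛ≤Knˢ u)))
  where
  open ≡-Reasoning
  n : ℕ
  n = length A
  interpolation : E N (suc u) A ^ suc u ≤ n ^ 2 * E N (2 + u) A ^ u
  interpolation = ≤-trans (energy-interpolate-penultimate N u (ind A) (indNeg A))
                          (*-monoˡ-≤ (E N (2 + u) A ^ u) (E₁≤∣A∣² N A))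
  arithmetic : ∀ u → (2 + u) * (2 + u) + 2 ≡ 2 * (2 + u) + (2 + (2 + u) * u)
  arithmetic = solve-∀
  exponents : n ^ 2 * (n ^ (2 + u)) ^ u ≡ n ^ ((2 + u) * (2 + u) + 2 ∸ 2 * (2 + u))
  exponents = begin
    n ^ 2 * (n ^ (2 + u)) ^ u      ≡⟨ cong (n ^ 2 *_) (^-*-assoc n (2 + u) u) ⟩
    n ^ 2 * n ^ ((2 + u) * u)      ≡⟨ ^-distribˡ-+-* n 2 ((2 + u) * u) ⟨
    n ^ (2 + (2 + u) * u)          ≡⟨ cong (n ^_) (m+n∸m≡n (2 * (2 + u)) (2 + (2 + u) * u)) ⟨
    n ^ (2 * (2 + u) + (2 + (2 + u) * u) ∸ 2 * (2 + u))  ≡⟨ cong (λ e → n ^ (e ∸ 2 * (2 + u))) (arithmetic u) ⟨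
    n ^ ((2 + u) * (2 + u) + 2 ∸ 2 * (2 + u))  ∎

^ℚ-≤⇒≤[] : ∀ a n e {K} → toℚ a ℚ.≤ K ℚ.* toℚ n ^ℚ e → a ≤[ K ] n ^ e
^ℚ-≤⇒≤[] a n e {K} a≤Knᵉ = scaled (subst (λ x → toℚ a ℚ.≤ K ℚ.* x) (sym (toℚ-^ n e)) a≤Knᵉ)

≤[]⇒^ℚ-≤ : ∀ a k n e {K C} → K ℚ.≤ C → a ^ k ≤[ K ] n ^ e → toℚ a ^ℚ k ℚ.≤ C ℚ.* toℚ n ^ℚ e
≤[]⇒^ℚ-≤ a k n e {C = C} K≤C aᵏ≤Knᵉ =
  subst₂ ℚ._≤_ (toℚ-^ a k) (cong (C ℚ.*_) (toℚ-^ n e)) (toℚ-≤ (≤[]-weaken K≤C aᵏ≤Knᵉ))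

lemma2p1 : (s : ℕ) → 2 ≤ s → (K : ℚ) → Positive K →
  Σ ℚ λ C → Positive C ×
    ((N : ℕ) → 1 ≤ N → (A : List ℕ) → Unique A →
      All (λ a → 1 ≤ a × a ≤ N) A →
      toℚ (E N s A) ℚ.≤ K ℚ.* (toℚ (length A) ^ℚ s) →
      (toℚ (E N 2 A) ^ℚ (s ∸ 1) ℚ.≤ (C ^ℚ (s ∸ 1)) ℚ.* (toℚ (length A) ^ℚ (3 * s ∸ 4)))
      × (toℚ (E N (s ∸ 1) A) ^ℚ (s ∸ 1) ℚ.≤ (C ^ℚ (s ∸ 1)) ℚ.* (toℚ (length A) ^ℚ (s * s + 2 ∸ 2 * s))))
lemma2p1 (suc (suc u)) (s≤s (s≤s z≤n)) K K>0 = C , ℚₚ.pos+nonNeg⇒pos ℚ.1ℚ K , λ N _ A _ _ Eₛ≤Knˢ →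
  let s = 2 + u
      n = length A
      Eₛ≤[K]nˢ = ^ℚ-≤⇒≤[] (E N s A) n s Eₛ≤Knˢ
  in ≤[]⇒^ℚ-≤ (E N 2 A) (s ∸ 1) n (3 * s ∸ 4) K≤Cᵘ⁺¹ (E₂-bound N A u Eₛ≤[K]nˢ)
   , ≤[]⇒^ℚ-≤ (E N (s ∸ 1) A) (s ∸ 1) n (s * s + 2 ∸ 2 * s) Kᵘ≤Cᵘ⁺¹ (E-penultimate-bound N A u Eₛ≤[K]nˢ)
  where
  instance
    K≥0 : NonNegative K
    K≥0 = ℚₚ.pos⇒nonNeg K {{K>0}}
  C : ℚ
  C = ℚ.1ℚ ℚ.+ K
  K≤C : K ℚ.≤ C
  K≤C = p≤q+p K ℚ.1ℚ
  1≤C : ℚ.1ℚ ℚ.≤ C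
  1≤C = subst (ℚ.1ℚ ℚ.≤_) (ℚₚ.+-comm K ℚ.1ℚ) (p≤q+p ℚ.1ℚ K)
  K≤Cᵘ⁺¹ : K ℚ.≤ C ^ℚ suc u
  K≤Cᵘ⁺¹ = ℚₚ.≤-trans K≤C (subst (ℚ._≤ C ^ℚ suc u) (ℚₚ.*-identityʳ C) (^ℚ-monoʳ-≤ 1≤C {1} {suc u} (s≤s z≤n)))
  Kᵘ≤Cᵘ⁺¹ : K ^ℚ u ℚ.≤ C ^ℚ suc u
  Kᵘ≤Cᵘ⁺¹ = ℚₚ.≤-trans (^ℚ-monoˡ-≤ K≤C u) (^ℚ-monoʳ-≤ 1≤C {u} {suc u} (n≤1+n u))
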